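{- Let $G$ and $H$ be two nontrivial connected graphs with $hn_{cc}(H)=2$. Then $hn_{cc}(G)\le hn_{cc}(G\Box H)\le hn_{cc}(G)+1$. Moreover, $hn_{cc}(G\Box H)=hn_{cc}(G)$ if and only if there is a minimum hull set $S$ of $G$ such that $S$ can be partitioned into two sets $S_1$ and $S_2$ with $\langle S_1\rangle_C\cap\langle S_2\rangle_C\neq\emptyset$.
   Context: All graphs are finite, simple and undirected. Cycle convexity on a graph $G$: for $S\subseteq V(G)$, the cycle interval $\langle S\rangle$ is $S$ together with every vertex $w\in V(G)$ that lies on a cycle of the induced subgraph $G[S\cup\{w\}]$ passing through $w$. $S$ is (cycle) convex if $\langle S\rangle=S$. The cycle convex hull $\langle S\rangle_C$ is the smallest convex set containing $S$ (computed in $G$). $S$ is a hull set if $\langle S\rangle_C=V(G)$; a minimum hull set is a hull set of minimum cardinality, and $hn_{cc}(G)$ is that minimum cardinality. The Cartesian product $G\Box H$ has vertex set $V(G)\times V(H)$, with $(g_1,h_1)\sim(g_2,h_2)$ iff ($g_1\sim g_2$ and $h_1=h_2$) or ($g_1=g_2$ and $h_1\sim h_2$). A graph is nontrivial if it has at least two vertices. -}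

module Defs where

open import Data.Nat using (ℕ; zero; suc; _*_; _≤_)
open import Data.Bool using (Bool; true; false; _∧_; _∨_)
open import Data.Fin using (Fin; zero; suc; inject₁; fromℕ; remQuot)
open import Data.Fin.Subset using (Subset; _∈_; _⊆_; _∪_; _∩_; ∣_∣)
open import Data.Product using (Σ; ∃; _×_; _,_; proj₁; proj₂)
open import Data.Sum using (_⊎_)
open import Relation.Binary.PropositionalEquality using (_≡_; refl; sym)
open import Data.Empty using (⊥-elim)
open import Relation.Nullary using (¬_; yes; no)
open import Function.Definitions using (Injective)
open import Data.Fin.Properties using (_≟_)
open import Relation.Nullary.Decidable using (⌊_⌋)

record Graph : Set where
  field
    n      : ℕ
    adj    : Fin n → Fin n → Bool
    adj-sym : ∀ u v → adj u v ≡ adj v u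
    irrefl : ∀ v → adj v v ≡ false
open Graph public

V : Graph → Set
V G = Fin (n G)

Adj : (G : Graph) → V G → V G → Set
Adj G u v = adj G u v ≡ true

Nontrivial : Graph → Set
Nontrivial G = 2 ≤ n G

data Walk (G : Graph) : V G → V G → Set where
  [] : ∀ {u} → Walk G u u
  _∷_ : ∀ {u v w} → Adj G u v → Walk G v w → Walk G u w

Connected : Graph → Set
Connected G = ∀ (u v : V G) → Walk G u v

-- w lies on a cycle of G[S ∪ {w}] passing through w:
-- distinct vertices c 0 = w, c 1, ..., c k (k ≥ 2, so length ≥ 3), with
-- c 1..c k in S, consecutive vertices adjacent, and c k adjacent to c 0.
OnCycle : (G : Graph) → Subset (n G) → V G → Set
OnCycle G S w =
  Σ ℕ λ k → (2 ≤ k) × Σ (Fin (suc k) → V G) λ c →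
    Injective _≡_ _≡_ c
    × c zero ≡ w
    × (∀ (i : Fin k) → c (suc i) ∈ S)
    × (∀ (i : Fin k) → Adj G (c (inject₁ i)) (c (suc i)))
    × Adj G (c (fromℕ k)) (c zero)

InInterval : (G : Graph) → Subset (n G) → V G → Set
InInterval G S v = v ∈ S ⊎ OnCycle G S v

Convex : (G : Graph) → Subset (n G) → Set
Convex G S = ∀ v → InInterval G S v → v ∈ S

InHull : (G : Graph) → Subset (n G) → V G → Set
InHull G S v = ∀ (T : Subset (n G)) → S ⊆ T → Convex G T → v ∈ T

HullSet : (G : Graph) → Subset (n G) → Set
HullSet G S = ∀ v → InHull G S v

MinimumHullSet : (G : Graph) → Subset (n G) → Set
MinimumHullSet G S = HullSet G S × (∀ T → HullSet G T → ∣ S ∣ ≤ ∣ T ∣)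

IsHullNumber : Graph → ℕ → Set
IsHullNumber G k = Σ (Subset (n G)) λ S → MinimumHullSet G S × ∣ S ∣ ≡ k

-- Cartesian product G □ H, vertex set Fin (n G * n H) ≅ Fin (n G) × Fin (n H) via remQuot.
eqb : ∀ {m} → Fin m → Fin m → Bool
eqb a b = ⌊ a ≟ b ⌋

eqb-sym : ∀ {m} (a b : Fin m) → eqb a b ≡ eqb b a
eqb-sym a b with a ≟ b | b ≟ a
... | yes _ | yes _ = refl
... | no _ | no _ = refl
... | yes p | no q = ⊥-elim (q (sym p))
... | no p | yes q = ⊥-elim (p (sym q))

eqb-refl : ∀ {m} (a : Fin m) → eqb a a ≡ true
eqb-refl a with a ≟ a
... | yes _ = refl
... | no p = ⊥-elim (p refl)

pairAdj : (G H : Graph) → V G × V H → V G × V H → Bool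
pairAdj G H (g₁ , h₁) (g₂ , h₂) =
  (adj G g₁ g₂ ∧ eqb h₁ h₂) ∨ (eqb g₁ g₂ ∧ adj H h₁ h₂)

pairAdj-sym : (G H : Graph) → ∀ p q → pairAdj G H p q ≡ pairAdj G H q p
pairAdj-sym G H (g₁ , h₁) (g₂ , h₂)
  rewrite adj-sym G g₁ g₂ | eqb-sym h₁ h₂ | eqb-sym g₁ g₂ | adj-sym H h₁ h₂ = refl

pairAdj-irrefl : (G H : Graph) → ∀ p → pairAdj G H p p ≡ false
pairAdj-irrefl G H (g , h) rewrite irrefl G g | irrefl H h | eqb-refl g = refl

_□_ : Graph → Graph → Graph
G □ H = record
  { n = n G * n H
  ; adj = λ x y → pairAdj G H (remQuot {n G} (n H) x) (remQuot {n G} (n H) y)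
  ; adj-sym = λ x y → pairAdj-sym G H (remQuot {n G} (n H) x) (remQuot {n G} (n H) y)
  ; irrefl = λ x → pairAdj-irrefl G H (remQuot {n G} (n H) x)
  }

PartitionCondition : Graph → Set
PartitionCondition G =
  Σ (Subset (n G)) λ S → MinimumHullSet G S ×
  Σ (Subset (n G)) λ S₁ → Σ (Subset (n G)) λ S₂ →
    (S₁ ∪ S₂ ≡ S) × (∀ v → ¬ (v ∈ S₁ × v ∈ S₂)) ×
    (∃ λ v → InHull G S₁ v × InHull G S₂ v)

{-# OPTIONS --safe #-}
-- Write SH = {a, b} for the hull set of H, and call G × {h} a layer and {g} × H a fibre of G □ H.
-- A convex set of G □ H meets every layer and every fibre in a convex set, and if it contains three
-- corners (g, h), (g′, h), (g, h′) of a square it contains the fourth, which those corners bridge.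
-- Hence a convex set containing a whole fibre and a whole layer is everything, and a convex set
-- containing (g, a) and (g, b) contains the fibre over g.
--
-- Lower bound: the projection of a hull set of G □ H is a hull set of G, because preimages of convex
-- sets of G are convex. Upper bound: S × {a} ∪ {(s, b)} is a hull set for every hull set S of G.
-- If S = S₁ ⊎ S₂ and v ∈ ⟨S₁⟩ ∩ ⟨S₂⟩, place S on layer a except for the vertices of S₂ in the
-- component K of v in ⟨S₂⟩, which go to layer b. Any convex superset then contains (v, a) and K × {b},
-- hence the fibres over v and over all of K, hence the layer G × {a}. Conversely, a hull set T of size
-- hn(G) projects injectively to G, and the hulls ⟨Tₕ⟩ of its layers must meet, since otherwise
-- ⋃ₕ ⟨Tₕ⟩ × {h} would be a convex set containing T, forcing every ⟨Tₕ⟩ to be all of G. For two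
-- meeting layers, S₁ = Tₕ and S₂ = π₁(T) ∖ Tₕ give the partition.
module Submission where

open import Defs
open import Data.Nat using (ℕ; zero; suc; _+_; _∸_; _≤_; _<_; z≤n; s≤s)
open import Data.Nat.Properties as ℕ using (≤-trans; ≤-reflexive; n≤1+n)
open import Data.Bool using (true; false; _∧_; _∨_; if_then_else_)
import Data.Bool.Properties as Bool
open import Data.Fin using (Fin; zero; suc; toℕ; fromℕ; fromℕ<; inject₁; combine; remQuot)
open import Data.Fin.Properties
  using (any?; all?; _≟_; 0≢1+n; suc-injective; toℕ-injective; toℕ<n; toℕ≤pred[n]; toℕ-fromℕ; toℕ-fromℕ<;
         toℕ-inject₁; remQuot-combine; combine-remQuot)
open import Data.Fin.Subset
  using (Subset; _∈_; _∉_; _⊆_; _⊃_; _∩_; _∪_; _─_; _-_; ∁; ⊤; ⊥; ⁅_⁆; ∣_∣; Lift; Nonempty; inside; outside)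
open import Data.Fin.Subset.Properties
  using (_∈?_; _⊆?_; anySubset?; nonempty?; Empty-unique; ⊆-antisym; ∈⊤; ∣⊥∣≡0; p⊆q⇒∣p∣≤∣q∣;
         x∈⁅x⁆; x∈⁅y⁆⇒x≡y; x∈p∩q⁺; x∈p∩q⁻; p∩q⊆p; x∈p∪q⁺; x∈p∪q⁻; x∉p⇒x∈∁p; x∈∁p⇒x∉p;
         p─⊥≡p; p─q⊆p; x∈p∧x∉q⇒x∈p─q; x∈p∧x≢y⇒x∈p-y; x∈p⇒∣p-x∣<∣p∣)
open import Data.Fin.Subset.Induction using (⊃-wellFounded)
open import Data.Vec using (_∷_; []; tabulate; here; there)
open import Data.Vec.Properties using (lookup∘tabulate; lookup⇒[]=; []=⇒lookup)
open import Data.Product using (∃; ∃₂; _×_; _,_; proj₁; proj₂)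
open import Data.Sum using (_⊎_; inj₁; inj₂)
open import Function using (id; _∘_; case_of_)
open import Function.Bundles using (_⇔_; mk⇔)
open import Function.Definitions using (Injective)
open import Induction.WellFounded using (Acc; acc)
open import Relation.Nullary using (¬_; Dec; yes; no; does; contradiction)
open import Relation.Nullary.Decidable
  using (dec-true; dec-false; decidable-stable; map′; _×-dec_; _⊎-dec_; _→-dec_; ¬?)
open import Relation.Binary.PropositionalEquality
  using (_≡_; _≢_; refl; sym; trans; cong; cong₂; subst; subst₂)
open import Relation.Unary using (Pred; Decidable)

module _ {m ℓ} {P : Pred (Fin m) ℓ} (P? : Decidable P) where

  subsetOf : Subset m
  subsetOf = tabulate (does ∘ P?)

  ∈-subsetOf⁺ : ∀ {x} → P x → x ∈ subsetOf
  ∈-subsetOf⁺ {x} px = lookup⇒[]= x _ (trans (lookup∘tabulate _ x) (dec-true (P? x) px))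

  ∈-subsetOf⁻ : ∀ {x} → x ∈ subsetOf → P x
  ∈-subsetOf⁻ {x} x∈ with P? x | trans (sym (lookup∘tabulate (does ∘ P?) x)) ([]=⇒lookup x∈)
  ... | yes px | _  = px
  ... | no _   | ()

∣p∣≤1+∣p-x∣ : ∀ {m} (p : Subset m) x → ∣ p ∣ ≤ suc ∣ p - x ∣
∣p∣≤1+∣p-x∣ (inside  ∷ p) zero    = s≤s (≤-reflexive (cong ∣_∣ (sym (p─⊥≡p p))))
∣p∣≤1+∣p-x∣ (outside ∷ p) zero    = ≤-trans (n≤1+n _) (s≤s (≤-reflexive (cong ∣_∣ (sym (p─⊥≡p p)))))
∣p∣≤1+∣p-x∣ (inside  ∷ p) (suc x) = s≤s (∣p∣≤1+∣p-x∣ p x)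
∣p∣≤1+∣p-x∣ (outside ∷ p) (suc x) = ∣p∣≤1+∣p-x∣ p x

x∉p-x : ∀ {m} (p : Subset m) x → x ∉ p - x
x∉p-x (_ ∷ p) zero    ()
x∉p-x (_ ∷ p) (suc x) (there x∈) = x∉p-x p x x∈

x∈p-y⇒x≢y : ∀ {m} {p : Subset m} {x y} → x ∈ p - y → x ≢ y
x∈p-y⇒x≢y {p = p} x∈ refl = x∉p-x p _ x∈

x∈p⇒0<∣p∣ : ∀ {m} {p : Subset m} {x} → x ∈ p → 0 < ∣ p ∣
x∈p⇒0<∣p∣ x∈ = ≤-trans (s≤s z≤n) (x∈p⇒∣p-x∣<∣p∣ x∈)

0<∣p∣⇒nonempty : ∀ {m} (p : Subset m) → 0 < ∣ p ∣ → Nonempty p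
0<∣p∣⇒nonempty {m} p 0<∣p∣ with nonempty? p
... | yes ne = ne
... | no empty = contradiction (trans (cong ∣_∣ (Empty-unique empty)) (∣⊥∣≡0 m)) (ℕ.>⇒≢ 0<∣p∣)

∣p∣≤1⇒x≡y : ∀ {m} {p : Subset m} {x y} → ∣ p ∣ ≤ 1 → x ∈ p → y ∈ p → x ≡ y
∣p∣≤1⇒x≡y {x = x} {y} ∣p∣≤1 x∈ y∈ with y ≟ x
... | yes y≡x = sym y≡x
... | no y≢x = contradiction
  (≤-trans (s≤s (x∈p⇒0<∣p∣ (x∈p∧x≢y⇒x∈p-y y∈ y≢x))) (x∈p⇒∣p-x∣<∣p∣ x∈)) (ℕ.≤⇒≯ ∣p∣≤1)

∣p∣≡2⇒pair : ∀ {m} (p : Subset m) → ∣ p ∣ ≡ 2 →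
  ∃₂ λ a b → a ≢ b × (∀ {x} → x ∈ p → x ≡ a ⊎ x ≡ b)
∣p∣≡2⇒pair p ∣p∣≡2 with 0<∣p∣⇒nonempty p (subst (0 <_) (sym ∣p∣≡2) (s≤s z≤n))
... | a , a∈p with 0<∣p∣⇒nonempty (p - a) (ℕ.≤-pred (subst (_≤ suc ∣ p - a ∣) ∣p∣≡2 (∣p∣≤1+∣p-x∣ p a)))
...   | b , b∈p-a = a , b , (λ a≡b → x∈p-y⇒x≢y b∈p-a (sym a≡b)) , cover
  where
  ∣p-a∣≤1 : ∣ p - a ∣ ≤ 1
  ∣p-a∣≤1 = ℕ.≤-pred (subst (suc ∣ p - a ∣ ≤_) ∣p∣≡2 (x∈p⇒∣p-x∣<∣p∣ a∈p))
  cover : ∀ {x} → x ∈ p → x ≡ a ⊎ x ≡ b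
  cover {x} x∈p with x ≟ a
  ... | yes x≡a = inj₁ x≡a
  ... | no x≢a  = inj₂ (∣p∣≤1⇒x≡y ∣p-a∣≤1 (x∈p∧x≢y⇒x∈p-y x∈p x≢a) b∈p-a)

onto⇒∣q∣≤∣p∣ : ∀ {m k} (f : Fin m → Fin k) (p : Subset m) (q : Subset k) →
  (∀ {y} → y ∈ q → ∃ λ x → x ∈ p × f x ≡ y) → ∣ q ∣ ≤ ∣ p ∣
onto⇒∣q∣≤∣p∣ {k = k} f [] q onto =
  ≤-trans (p⊆q⇒∣p∣≤∣q∣ {q = ⊥} (λ y∈q → case onto y∈q of λ ())) (≤-reflexive (∣⊥∣≡0 k))
onto⇒∣q∣≤∣p∣ f (outside ∷ p) q onto = onto⇒∣q∣≤∣p∣ (f ∘ suc) p q onto′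
  where
  onto′ : ∀ {y} → y ∈ q → ∃ λ x → x ∈ p × f (suc x) ≡ y
  onto′ y∈q with onto y∈q
  ... | suc x , there x∈p , fx≡y = x , x∈p , fx≡y
onto⇒∣q∣≤∣p∣ f (inside ∷ p) q onto =
  ≤-trans (∣p∣≤1+∣p-x∣ q (f zero)) (s≤s (onto⇒∣q∣≤∣p∣ (f ∘ suc) p (q - f zero) onto′))
  where
  onto′ : ∀ {y} → y ∈ q - f zero → ∃ λ x → x ∈ p × f (suc x) ≡ y
  onto′ y∈q-f0 with onto (p─q⊆p _ _ y∈q-f0)
  ... | zero  , _          , f0≡y = contradiction (sym f0≡y) (x∈p-y⇒x≢y y∈q-f0)
  ... | suc x , there x∈p , fx≡y = x , x∈p , fx≡y

∣p∪⁅x⁆∣≤1+∣p∣ : ∀ {m} (p : Subset m) x → ∣ p ∪ ⁅ x ⁆ ∣ ≤ suc ∣ p ∣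
∣p∪⁅x⁆∣≤1+∣p∣ p x = ≤-trans (∣p∣≤1+∣p-x∣ (p ∪ ⁅ x ⁆) x) (s≤s (p⊆q⇒∣p∣≤∣q∣ removed⊆p))
  where
  removed⊆p : (p ∪ ⁅ x ⁆) - x ⊆ p
  removed⊆p y∈ with x∈p∪q⁻ p ⁅ x ⁆ (p─q⊆p _ _ y∈)
  ... | inj₁ y∈p    = y∈p
  ... | inj₂ y∈⁅x⁆ = contradiction (x∈⁅y⁆⇒x≡y _ y∈⁅x⁆) (x∈p-y⇒x≢y y∈)

x∈p─q⇒x∉q : ∀ {m} (p q : Subset m) {x} → x ∈ p ─ q → x ∉ q
x∈p─q⇒x∉q (_ ∷ p) (outside ∷ q) (there x∈) (there x∈q) = x∈p─q⇒x∉q p q x∈ x∈q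
x∈p─q⇒x∉q (_ ∷ p) (inside  ∷ q) (there x∈) (there x∈q) = x∈p─q⇒x∉q p q x∈ x∈q
x∈p─q⇒x∉q (inside ∷ p) (outside ∷ q) here ()

x∈p∪∁q∧x∈q⇒x∈p : ∀ {m} (p q : Subset m) {x} → x ∈ p ∪ ∁ q → x ∈ q → x ∈ p
x∈p∪∁q∧x∈q⇒x∈p p q x∈ x∈q with x∈p∪q⁻ p (∁ q) x∈
... | inj₁ x∈p  = x∈p
... | inj₂ x∈∁q = contradiction x∈q (x∈∁p⇒x∉p x∈∁q)

p⊆q⇒p∪q─p≡q : ∀ {m} {p q : Subset m} → p ⊆ q → p ∪ (q ─ p) ≡ q
p⊆q⇒p∪q─p≡q {p = p} {q} p⊆q = ⊆-antisym union⊆q q⊆union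
  where
  union⊆q : p ∪ (q ─ p) ⊆ q
  union⊆q x∈ with x∈p∪q⁻ p (q ─ p) x∈
  ... | inj₁ x∈p   = p⊆q x∈p
  ... | inj₂ x∈q─p = p─q⊆p q p x∈q─p
  q⊆union : q ⊆ p ∪ (q ─ p)
  q⊆union {x} x∈q with x ∈? p
  ... | yes x∈p = x∈p∪q⁺ (inj₁ x∈p)
  ... | no x∉p  = x∈p∪q⁺ (inj₂ (x∈p∧x∉q⇒x∈p─q x∈q x∉p))

module Closure {m} (step : Subset m → Subset m) (inflationary : ∀ X → X ⊆ step X) where

  Grows : Subset m → Set
  Grows X = ∃ λ x → x ∈ step X × x ∉ X

  grows? : ∀ X → Dec (Grows X)
  grows? X = any? λ x → (x ∈? step X) ×-dec ¬? (x ∈? X)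

  ¬grows⇒closed : ∀ {X} → ¬ Grows X → step X ⊆ X
  ¬grows⇒closed {X} stable {x} x∈ = decidable-stable (x ∈? X) λ x∉ → stable (x , x∈ , x∉)

  closureAcc : ∀ X → Acc _⊃_ X → Subset m
  closureAcc X (acc rs) with grows? X
  ... | yes grows = closureAcc (step X) (rs (inflationary X , grows))
  ... | no _      = X

  ⊆-closureAcc : ∀ X a → X ⊆ closureAcc X a
  ⊆-closureAcc X (acc rs) with grows? X
  ... | yes grows = ⊆-closureAcc (step X) (rs (inflationary X , grows)) ∘ inflationary X
  ... | no _      = λ x∈X → x∈X

  closureAcc-closed : ∀ X a → step (closureAcc X a) ⊆ closureAcc X a
  closureAcc-closed X (acc rs) with grows? X
  ... | yes grows  = closureAcc-closed (step X) (rs (inflationary X , grows))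
  ... | no stable  = ¬grows⇒closed stable

  closureAcc-induction : ∀ {ℓ} {P : Pred (Fin m) ℓ} X a → Lift P X →
    (∀ Y → Lift P Y → Lift P (step Y)) → Lift P (closureAcc X a)
  closureAcc-induction X (acc rs) PX step-pres with grows? X
  ... | yes grows = closureAcc-induction (step X) (rs (inflationary X , grows)) (step-pres X PX) step-pres
  ... | no _      = PX

  closure : Subset m → Subset m
  closure X = closureAcc X (⊃-wellFounded X)

  ⊆-closure : ∀ X → X ⊆ closure X
  ⊆-closure X = ⊆-closureAcc X (⊃-wellFounded X)

  closure-closed : ∀ X → step (closure X) ⊆ closure X
  closure-closed X = closureAcc-closed X (⊃-wellFounded X)

  closure-induction : ∀ {ℓ} {P : Pred (Fin m) ℓ} X → Lift P X →
    (∀ Y → Lift P Y → Lift P (step Y)) → Lift P (closure X)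
  closure-induction X = closureAcc-induction X (⊃-wellFounded X)

Adj? : ∀ Γ u v → Dec (Adj Γ u v)
Adj? Γ u v = adj Γ u v Bool.≟ true

Adj-sym : ∀ Γ {u v} → Adj Γ u v → Adj Γ v u
Adj-sym Γ {u} {v} u~v = trans (adj-sym Γ v u) u~v

Adj⇒≢ : ∀ Γ {u v} → Adj Γ u v → u ≢ v
Adj⇒≢ Γ {u} u~u refl with trans (sym u~u) (irrefl Γ u)
... | ()

infixr 5 _∷⟨_⟩_

data WalkIn (Γ : Graph) (S : Subset (n Γ)) : V Γ → V Γ → Set where
  [_]    : ∀ {u} → u ∈ S → WalkIn Γ S u u
  _∷⟨_⟩_ : ∀ {u v w} → u ∈ S → Adj Γ u v → WalkIn Γ S v w → WalkIn Γ S u w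

module _ {Γ : Graph} {S : Subset (n Γ)} where

  head∈ : ∀ {u v} → WalkIn Γ S u v → u ∈ S
  head∈ [ u∈S ]         = u∈S
  head∈ (u∈S ∷⟨ _ ⟩ _) = u∈S

  last∈ : ∀ {u v} → WalkIn Γ S u v → v ∈ S
  last∈ [ v∈S ]          = v∈S
  last∈ (_ ∷⟨ _ ⟩ rest) = last∈ rest

  infixl 5 _∷ʳ⟨_⟩_
  _∷ʳ⟨_⟩_ : ∀ {u v w} → WalkIn Γ S u v → Adj Γ v w → w ∈ S → WalkIn Γ S u w
  [ v∈S ]            ∷ʳ⟨ v~w ⟩ w∈S = v∈S ∷⟨ v~w ⟩ [ w∈S ]
  (u∈S ∷⟨ u~x ⟩ rest) ∷ʳ⟨ v~w ⟩ w∈S = u∈S ∷⟨ u~x ⟩ (rest ∷ʳ⟨ v~w ⟩ w∈S)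

module _ {Γ Δ : Graph} {S : Subset (n Γ)} {T : Subset (n Δ)} (f : V Γ → V Δ)
         (f-adj : ∀ {u v} → Adj Γ u v → Adj Δ (f u) (f v)) (f-∈ : ∀ {u} → u ∈ S → f u ∈ T) where

  map-WalkIn : ∀ {u v} → WalkIn Γ S u v → WalkIn Δ T (f u) (f v)
  map-WalkIn [ u∈S ]            = [ f-∈ u∈S ]
  map-WalkIn (u∈S ∷⟨ u~v ⟩ rest) = f-∈ u∈S ∷⟨ f-adj u~v ⟩ map-WalkIn rest

WalkIn-mono : ∀ {Γ} {S T : Subset (n Γ)} → S ⊆ T → ∀ {u v} → WalkIn Γ S u v → WalkIn Γ T u v
WalkIn-mono {Γ} S⊆T = map-WalkIn {Γ} {Γ} id id S⊆T

-- For w ∉ S this is equivalent to OnCycle Γ S w (bridged⇒onCycle, onCycle⇒bridged), but walks need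
-- not be simple, which makes them far easier to build.
record Bridged (Γ : Graph) (S : Subset (n Γ)) (w : V Γ) : Set where
  constructor bridge
  field
    {p q} : V Γ
    p≢q   : p ≢ q
    w~p   : Adj Γ w p
    w~q   : Adj Γ w q
    p⇝q   : WalkIn Γ S p q

map-Bridged : ∀ {Γ Δ : Graph} {S : Subset (n Γ)} {T : Subset (n Δ)} (f : V Γ → V Δ) →
  (∀ {u v} → f u ≡ f v → u ≡ v) → (∀ {u v} → Adj Γ u v → Adj Δ (f u) (f v)) →
  (∀ {u} → u ∈ S → f u ∈ T) → ∀ {w} → Bridged Γ S w → Bridged Δ T (f w)
map-Bridged {Γ} {Δ} f f-inj f-adj f-∈ (bridge p≢q w~p w~q p⇝q) =
  bridge (p≢q ∘ f-inj) (f-adj w~p) (f-adj w~q) (map-WalkIn {Γ} {Δ} f f-adj f-∈ p⇝q)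

Bridged-mono : ∀ {Γ} {S T : Subset (n Γ)} → S ⊆ T → ∀ {w} → Bridged Γ S w → Bridged Γ T w
Bridged-mono {Γ} S⊆T = map-Bridged {Γ} {Γ} id id id S⊆T

-- Indexed by ℕ so that suffixes are shifts; only the indices ≤ len are meaningful.
record Path (Γ : Graph) (S : Subset (n Γ)) (p q : V Γ) : Set where
  constructor path
  field
    len       : ℕ
    vertex    : ℕ → V Γ
    injective : ∀ {i j} → i ≤ len → j ≤ len → vertex i ≡ vertex j → i ≡ j
    within    : ∀ {i} → i ≤ len → vertex i ∈ S
    adjacent  : ∀ {i} → i < len → Adj Γ (vertex i) (vertex (suc i))
    start     : vertex 0 ≡ p
    end       : vertex len ≡ q

module _ {Γ : Graph} {S : Subset (n Γ)} where

  trivialPath : ∀ {p} → p ∈ S → Path Γ S p p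
  trivialPath {p} p∈S = path 0 (λ _ → p) (λ i≤0 j≤0 _ → trans (ℕ.n≤0⇒n≡0 i≤0) (sym (ℕ.n≤0⇒n≡0 j≤0)))
    (λ _ → p∈S) (λ ()) refl refl

  dropPath : ∀ {p q} (P : Path Γ S p q) {i} → i ≤ Path.len P → Path Γ S (Path.vertex P i) q
  dropPath (path len vertex injective within adjacent start end) {i} i≤len =
    path (len ∸ i) (λ j → vertex (j + i))
      (λ j≤ k≤ eq → ℕ.+-cancelʳ-≡ i _ _ (injective (shift j≤) (shift k≤) eq))
      (within ∘ shift) (adjacent ∘ shift) refl (trans (cong vertex (ℕ.m∸n+n≡m i≤len)) end)
    where
    shift : ∀ {j} → j ≤ len ∸ i → j + i ≤ len
    shift j≤ = ≤-trans (ℕ.+-monoˡ-≤ i j≤) (≤-reflexive (ℕ.m∸n+n≡m i≤len))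

  consPath : ∀ {u p q} → u ∈ S → Adj Γ u p → (P : Path Γ S p q) →
    (∀ {i} → i ≤ Path.len P → Path.vertex P i ≢ u) → Path Γ S u q
  consPath {u} u∈S u~p (path len vertex injective within adjacent start end) u∉P =
    path (suc len) vertex′ injective′ within′ adjacent′ refl end
    where
    vertex′ : ℕ → V Γ
    vertex′ zero    = u
    vertex′ (suc i) = vertex i
    injective′ : ∀ {i j} → i ≤ suc len → j ≤ suc len → vertex′ i ≡ vertex′ j → i ≡ j
    injective′ {zero}  {zero}  _         _         _  = refl
    injective′ {zero}  {suc j} _         (s≤s j≤) eq = contradiction (sym eq) (u∉P j≤)
    injective′ {suc i} {zero}  (s≤s i≤) _         eq = contradiction eq (u∉P i≤)
    injective′ {suc i} {suc j} (s≤s i≤) (s≤s j≤) eq = cong suc (injective i≤ j≤ eq)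
    within′ : ∀ {i} → i ≤ suc len → vertex′ i ∈ S
    within′ {zero}  _        = u∈S
    within′ {suc i} (s≤s i≤) = within i≤
    adjacent′ : ∀ {i} → i < suc len → Adj Γ (vertex′ i) (vertex′ (suc i))
    adjacent′ {zero}  _        = subst (Adj Γ u) (sym start) u~p
    adjacent′ {suc i} (s≤s i<) = adjacent i<

  walk⇒path : ∀ {p q} → WalkIn Γ S p q → Path Γ S p q
  walk⇒path [ p∈S ] = trivialPath p∈S
  walk⇒path {u} (u∈S ∷⟨ u~v ⟩ rest)
    with P ← walk⇒path rest | any? (λ (i : Fin (suc (Path.len P))) → Path.vertex P (toℕ i) ≟ u)
  ... | yes (i , vᵢ≡u) = subst (λ x → Path Γ S x _) vᵢ≡u (dropPath P (toℕ≤pred[n] i))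
  ... | no u∉P = consPath u∈S u~v P λ {i} i≤ vᵢ≡u →
          u∉P (fromℕ< (s≤s i≤) , trans (cong (Path.vertex P) (toℕ-fromℕ< (s≤s i≤))) vᵢ≡u)

module _ {Γ : Graph} {S : Subset (n Γ)} where

  bridged⇒onCycle : ∀ {w} → w ∉ S → Bridged Γ S w → OnCycle Γ S w
  bridged⇒onCycle {w} w∉S (bridge {p} {q} p≢q w~p w~q p⇝q) = cycle (walk⇒path p⇝q)
    where
    cycle : Path Γ S p q → OnCycle Γ S w
    cycle (path zero _ _ _ _ start end) = contradiction (trans (sym start) end) p≢q
    cycle (path (suc m) vertex injective within adjacent start end) =
      suc (suc m) , s≤s (s≤s z≤n) , c , c-injective , refl , within ∘ bound , c-adjacent , c-closes
      where
      c : Fin (suc (suc (suc m))) → V Γ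
      c zero    = w
      c (suc i) = vertex (toℕ i)
      bound : (i : Fin (suc (suc m))) → toℕ i ≤ suc m
      bound = toℕ≤pred[n]
      c-injective : Injective _≡_ _≡_ c
      c-injective {zero}  {zero}  _  = refl
      c-injective {zero}  {suc j} eq = contradiction (subst (_∈ S) (sym eq) (within (bound j))) w∉S
      c-injective {suc i} {zero}  eq = contradiction (subst (_∈ S) eq (within (bound i))) w∉S
      c-injective {suc i} {suc j} eq = cong suc (toℕ-injective (injective (bound i) (bound j) eq))
      c-adjacent : ∀ (i : Fin (suc (suc m))) → Adj Γ (c (inject₁ i)) (c (suc i))
      c-adjacent zero    = subst (Adj Γ w) (sym start) w~p
      c-adjacent (suc i) = subst (λ k → Adj Γ (vertex k) (vertex (suc (toℕ i))))
                             (sym (toℕ-inject₁ i)) (adjacent (toℕ<n i))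
      c-closes : Adj Γ (c (fromℕ (suc (suc m)))) w
      c-closes = subst (λ k → Adj Γ (vertex k) w) (sym (toℕ-fromℕ (suc m)))
                   (subst (λ x → Adj Γ x w) (sym end) (Adj-sym Γ w~q))

  chain⇒walk : ∀ k (c : Fin (suc k) → V Γ) → (∀ i → c i ∈ S) →
    (∀ (i : Fin k) → Adj Γ (c (inject₁ i)) (c (suc i))) → WalkIn Γ S (c zero) (c (fromℕ k))
  chain⇒walk zero    c c∈S c~c = [ c∈S zero ]
  chain⇒walk (suc k) c c∈S c~c = c∈S zero ∷⟨ c~c zero ⟩ chain⇒walk k (c ∘ suc) (c∈S ∘ suc) (c~c ∘ suc)

  onCycle⇒bridged : ∀ {w} → OnCycle Γ S w → Bridged Γ S w
  onCycle⇒bridged (suc (suc m) , s≤s (s≤s z≤n) , c , c-injective , refl , c∈S , c~c , c-closes) =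
    bridge (0≢1+n ∘ suc-injective ∘ c-injective) (c~c zero) (Adj-sym Γ c-closes)
      (chain⇒walk (suc m) (c ∘ suc) c∈S (c~c ∘ suc))

BridgeClosed : (Γ : Graph) → Subset (n Γ) → Set
BridgeClosed Γ T = ∀ {w} → Bridged Γ T w → w ∈ T

convex⇒bridgeClosed : ∀ {Γ T} → Convex Γ T → BridgeClosed Γ T
convex⇒bridgeClosed {Γ} {T} convex {w} br with w ∈? T
... | yes w∈T = w∈T
... | no w∉T  = convex w (inj₂ (bridged⇒onCycle w∉T br))

bridgeClosed⇒convex : ∀ {Γ T} → BridgeClosed Γ T → Convex Γ T
bridgeClosed⇒convex closed w (inj₁ w∈T)     = w∈T
bridgeClosed⇒convex closed w (inj₂ onCycle) = closed (onCycle⇒bridged onCycle)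

module Reachability (Γ : Graph) (Z : Subset (n Γ)) where

  Extends : Subset (n Γ) → V Γ → Set
  Extends Y y = y ∈ Y ⊎ (y ∈ Z × ∃ λ u → u ∈ Y × Adj Γ u y)

  extends? : ∀ Y → Decidable (Extends Y)
  extends? Y y = (y ∈? Y) ⊎-dec ((y ∈? Z) ×-dec any? λ u → (u ∈? Y) ×-dec Adj? Γ u y)

  extend : Subset (n Γ) → Subset (n Γ)
  extend Y = subsetOf (extends? Y)

  open Closure extend (λ Y y∈Y → ∈-subsetOf⁺ (extends? Y) (inj₁ y∈Y))

  reach : V Γ → Subset (n Γ)
  reach p = closure (⁅ p ⁆ ∩ Z)

  reach⇒walk : ∀ {p q} → q ∈ reach p → WalkIn Γ Z p q
  reach⇒walk {p} = closure-induction (⁅ p ⁆ ∩ Z) start step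
    where
    start : Lift (WalkIn Γ Z p) (⁅ p ⁆ ∩ Z)
    start x∈ with x∈⁅p⁆ , x∈Z ← x∈p∩q⁻ _ _ x∈ with refl ← x∈⁅y⁆⇒x≡y _ x∈⁅p⁆ = [ x∈Z ]
    step : ∀ Y → Lift (WalkIn Γ Z p) Y → Lift (WalkIn Γ Z p) (extend Y)
    step Y walks y∈ with ∈-subsetOf⁻ (extends? Y) y∈
    ... | inj₁ y∈Y                   = walks y∈Y
    ... | inj₂ (y∈Z , u , u∈Y , u~y) = walks u∈Y ∷ʳ⟨ u~y ⟩ y∈Z

  reach-step : ∀ {p q r} → q ∈ reach p → r ∈ Z → Adj Γ q r → r ∈ reach p
  reach-step {p} q∈ r∈Z q~r =
    closure-closed (⁅ p ⁆ ∩ Z) (∈-subsetOf⁺ (extends? _) (inj₂ (r∈Z , _ , q∈ , q~r)))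

  reach-start : ∀ {p} → p ∈ Z → p ∈ reach p
  reach-start {p} p∈Z = ⊆-closure (⁅ p ⁆ ∩ Z) (x∈p∩q⁺ (x∈⁅x⁆ p , p∈Z))

  walkIn-reach : ∀ {p q r} → q ∈ reach p → WalkIn Γ Z q r → WalkIn Γ (reach p) q r
  walkIn-reach q∈ [ _ ]              = [ q∈ ]
  walkIn-reach q∈ (_ ∷⟨ q~v ⟩ rest) = q∈ ∷⟨ q~v ⟩ walkIn-reach (reach-step q∈ (head∈ rest) q~v) rest

  walk⇒reach : ∀ {p q} → WalkIn Γ Z p q → q ∈ reach p
  walk⇒reach p⇝q = last∈ (walkIn-reach (reach-start (head∈ p⇝q)) p⇝q)

open Reachability using (reach; reach⇒walk; reach-step; reach-start; walkIn-reach; walk⇒reach)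

Bridged? : ∀ Γ Z w → Dec (Bridged Γ Z w)
Bridged? Γ Z w = map′ toBridge fromBridge
  (any? λ p → any? λ q → ¬? (p ≟ q) ×-dec Adj? Γ w p ×-dec Adj? Γ w q ×-dec (q ∈? reach Γ Z p))
  where
  toBridge : (∃₂ λ p q → p ≢ q × Adj Γ w p × Adj Γ w q × q ∈ reach Γ Z p) → Bridged Γ Z w
  toBridge (p , q , p≢q , w~p , w~q , q∈) = bridge p≢q w~p w~q (reach⇒walk Γ Z q∈)
  fromBridge : Bridged Γ Z w → ∃₂ λ p q → p ≢ q × Adj Γ w p × Adj Γ w q × q ∈ reach Γ Z p
  fromBridge (bridge p≢q w~p w~q p⇝q) = _ , _ , p≢q , w~p , w~q , walk⇒reach Γ Z p⇝q

Convex? : ∀ Γ T → Dec (Convex Γ T)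
Convex? Γ T = map′ (λ closed → bridgeClosed⇒convex λ {w} → closed w)
                   (λ convex w → convex⇒bridgeClosed convex)
                   (all? λ w → Bridged? Γ T w →-dec (w ∈? T))

InHull? : ∀ Γ S v → Dec (InHull Γ S v)
InHull? Γ S v with anySubset? (λ T → (S ⊆? T) ×-dec Convex? Γ T ×-dec ¬? (v ∈? T))
... | yes (T , S⊆T , convex , v∉T) = no λ inHull → v∉T (inHull T S⊆T convex)
... | no ∄T = yes λ T S⊆T convex → decidable-stable (v ∈? T) λ v∉T → ∄T (T , S⊆T , convex , v∉T)

hull : (Γ : Graph) → Subset (n Γ) → Subset (n Γ)
hull Γ S = subsetOf (InHull? Γ S)

module _ {Γ : Graph} {S : Subset (n Γ)} where

  ∈-hull⁺ : ∀ {v} → InHull Γ S v → v ∈ hull Γ S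
  ∈-hull⁺ = ∈-subsetOf⁺ (InHull? Γ S)

  ∈-hull⁻ : ∀ {v} → v ∈ hull Γ S → InHull Γ S v
  ∈-hull⁻ = ∈-subsetOf⁻ (InHull? Γ S)

  ⊆-hull : S ⊆ hull Γ S
  ⊆-hull v∈S = ∈-hull⁺ λ T S⊆T _ → S⊆T v∈S

  hull-least : ∀ {T} → S ⊆ T → Convex Γ T → hull Γ S ⊆ T
  hull-least S⊆T convex v∈ = ∈-hull⁻ v∈ _ S⊆T convex

  hull-convex : Convex Γ (hull Γ S)
  hull-convex = bridgeClosed⇒convex {Γ} λ br → ∈-hull⁺ λ T S⊆T convex →
    convex⇒bridgeClosed {Γ} convex (Bridged-mono (hull-least S⊆T convex) br)

InHull-mono : ∀ {Γ} {S T : Subset (n Γ)} → S ⊆ T → ∀ {v} → InHull Γ S v → InHull Γ T v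
InHull-mono S⊆T inHull U T⊆U = inHull U (T⊆U ∘ S⊆T)

HullSet-mono : ∀ {Γ} {S T : Subset (n Γ)} → S ⊆ T → HullSet Γ S → HullSet Γ T
HullSet-mono {Γ} S⊆T hullSet v = InHull-mono {Γ} S⊆T (hullSet v)

reach-hull⊆convex : ∀ {Γ S C} v → Convex Γ C → (S ∩ reach Γ (hull Γ S) v) ⊆ C → reach Γ (hull Γ S) v ⊆ C
reach-hull⊆convex {Γ} {S} {C} v C-convex S∩K⊆C g∈K =
  Q∩K⊆C (hull-least S⊆Q Q-convex (last∈ (reach⇒walk Γ H g∈K))) g∈K
  where
  H = hull Γ S
  K = reach Γ H v
  Q = H ∩ (C ∪ ∁ K)
  Q⊆H : Q ⊆ H
  Q⊆H = p∩q⊆p H (C ∪ ∁ K)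
  Q∩K⊆C : ∀ {x} → x ∈ Q → x ∈ K → x ∈ C
  Q∩K⊆C x∈Q = x∈p∪∁q∧x∈q⇒x∈p C K (proj₂ (x∈p∩q⁻ H (C ∪ ∁ K) x∈Q))
  into-C : ∀ {x y} → x ∈ K → WalkIn Γ Q x y → WalkIn Γ C x y
  into-C x∈K [ x∈Q ]               = [ Q∩K⊆C x∈Q x∈K ]
  into-C x∈K (x∈Q ∷⟨ x~z ⟩ rest) =
    Q∩K⊆C x∈Q x∈K ∷⟨ x~z ⟩ into-C (reach-step Γ H x∈K (Q⊆H (head∈ rest)) x~z) rest
  S⊆Q : S ⊆ Q
  S⊆Q {x} x∈S = x∈p∩q⁺ (⊆-hull x∈S , in-C∪∁K (x ∈? K))
    where
    in-C∪∁K : Dec (x ∈ K) → x ∈ C ∪ ∁ K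
    in-C∪∁K (yes x∈K) = x∈p∪q⁺ (inj₁ (S∩K⊆C (x∈p∩q⁺ (x∈S , x∈K))))
    in-C∪∁K (no x∉K)  = x∈p∪q⁺ (inj₂ (x∉p⇒x∈∁p x∉K))
  Q-convex : Convex Γ Q
  Q-convex = bridgeClosed⇒convex {Γ} λ {w} br → x∈p∩q⁺ (in-H br , in-C∪∁K br (w ∈? K))
    where
    in-H : ∀ {w} → Bridged Γ Q w → w ∈ H
    in-H br = convex⇒bridgeClosed {Γ} hull-convex (Bridged-mono Q⊆H br)
    in-C∪∁K : ∀ {w} → Bridged Γ Q w → Dec (w ∈ K) → w ∈ C ∪ ∁ K
    in-C∪∁K br (no w∉K) = x∈p∪q⁺ (inj₂ (x∉p⇒x∈∁p w∉K))
    in-C∪∁K (bridge p≢q w~p w~q p⇝q) (yes w∈K) = x∈p∪q⁺ (inj₁ (convex⇒bridgeClosed {Γ} C-convex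
      (bridge p≢q w~p w~q (into-C (reach-step Γ H w∈K (Q⊆H (head∈ p⇝q)) w~p) p⇝q))))

walk⇒walkIn⊤ : ∀ {Γ u v} → Walk Γ u v → WalkIn Γ ⊤ u v
walk⇒walkIn⊤ []            = [ ∈⊤ ]
walk⇒walkIn⊤ (u~v ∷ rest) = ∈⊤ ∷⟨ u~v ⟩ walk⇒walkIn⊤ rest

eqb⇒≡ : ∀ {m} {a b : Fin m} → eqb a b ≡ true → a ≡ b
eqb⇒≡ {a = a} {b} eq with a ≟ b
eqb⇒≡ _  | yes a≡b = a≡b
eqb⇒≡ () | no _

∧∨∧⁻ : ∀ a b c d → (a ∧ b) ∨ (c ∧ d) ≡ true → (a ≡ true × b ≡ true) ⊎ (c ≡ true × d ≡ true)
∧∨∧⁻ true  true  _     _    _  = inj₁ (refl , refl)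
∧∨∧⁻ true  false true  true _  = inj₂ (refl , refl)
∧∨∧⁻ false _     true  true _  = inj₂ (refl , refl)
∧∨∧⁻ true  false true  false ()
∧∨∧⁻ true  false false _     ()
∧∨∧⁻ false _     true  false ()
∧∨∧⁻ false _     false _     ()

module Product (G H : Graph) where

  P : Graph
  P = G □ H

  π₁ : V P → V G
  π₁ x = proj₁ (remQuot {n G} (n H) x)

  π₂ : V P → V H
  π₂ x = proj₂ (remQuot {n G} (n H) x)

  ⟨_,_⟩ : V G → V H → V P
  ⟨ g , h ⟩ = combine g h

  π₁-⟨⟩ : ∀ g h → π₁ ⟨ g , h ⟩ ≡ g
  π₁-⟨⟩ g h = cong proj₁ (remQuot-combine g h)

  π₂-⟨⟩ : ∀ g h → π₂ ⟨ g , h ⟩ ≡ h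
  π₂-⟨⟩ g h = cong proj₂ (remQuot-combine g h)

  ⟨π₁,π₂⟩ : ∀ x → ⟨ π₁ x , π₂ x ⟩ ≡ x
  ⟨π₁,π₂⟩ = combine-remQuot {n G} (n H)

  ⟨⟩-injectiveˡ : ∀ {g g′ h h′} → ⟨ g , h ⟩ ≡ ⟨ g′ , h′ ⟩ → g ≡ g′
  ⟨⟩-injectiveˡ {g} {g′} {h} {h′} eq = trans (sym (π₁-⟨⟩ g h)) (trans (cong π₁ eq) (π₁-⟨⟩ g′ h′))

  ⟨⟩-injectiveʳ : ∀ {g g′ h h′} → ⟨ g , h ⟩ ≡ ⟨ g′ , h′ ⟩ → h ≡ h′
  ⟨⟩-injectiveʳ {g} {g′} {h} {h′} eq = trans (sym (π₂-⟨⟩ g h)) (trans (cong π₂ eq) (π₂-⟨⟩ g′ h′))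

  π-injective : ∀ {x y} → π₁ x ≡ π₁ y → π₂ x ≡ π₂ y → x ≡ y
  π-injective {x} {y} eq₁ eq₂ = trans (sym (⟨π₁,π₂⟩ x)) (trans (cong₂ ⟨_,_⟩ eq₁ eq₂) (⟨π₁,π₂⟩ y))

  Horizontal Vertical : V P → V P → Set
  Horizontal x y = Adj G (π₁ x) (π₁ y) × π₂ x ≡ π₂ y
  Vertical   x y = π₁ x ≡ π₁ y × Adj H (π₂ x) (π₂ y)

  □-adj⁻ : ∀ {x y} → Adj P x y → Horizontal x y ⊎ Vertical x y
  □-adj⁻ {x} {y} x~y
    with ∧∨∧⁻ (adj G (π₁ x) (π₁ y)) (eqb (π₂ x) (π₂ y)) (eqb (π₁ x) (π₁ y)) (adj H (π₂ x) (π₂ y)) x~y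
  ... | inj₁ (g~g′ , h≡h′) = inj₁ (g~g′ , eqb⇒≡ h≡h′)
  ... | inj₂ (g≡g′ , h~h′) = inj₂ (eqb⇒≡ g≡g′ , h~h′)

  adj-⟨⟩ : ∀ {g g′ h h′} → pairAdj G H (g , h) (g′ , h′) ≡ true → Adj P ⟨ g , h ⟩ ⟨ g′ , h′ ⟩
  adj-⟨⟩ {g} {g′} {h} {h′} =
    subst₂ (λ s t → pairAdj G H s t ≡ true) (sym (remQuot-combine g h)) (sym (remQuot-combine g′ h′))

  adj-horizontal : ∀ h {g g′} → Adj G g g′ → Adj P ⟨ g , h ⟩ ⟨ g′ , h ⟩
  adj-horizontal h {g} {g′} g~g′ =
    adj-⟨⟩ (cong₂ (λ s t → (s ∧ t) ∨ (eqb g g′ ∧ adj H h h)) g~g′ (eqb-refl h))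

  adj-vertical : ∀ g {h h′} → Adj H h h′ → Adj P ⟨ g , h ⟩ ⟨ g , h′ ⟩
  adj-vertical g {h} {h′} h~h′ =
    adj-⟨⟩ (trans (cong₂ (λ s t → (adj G g g ∧ eqb h h′) ∨ (s ∧ t)) (eqb-refl g) h~h′) (Bool.∨-zeroʳ _))

  layer : Subset (n P) → V H → Subset (n G)
  layer U h = subsetOf λ g → ⟨ g , h ⟩ ∈? U

  fiber : Subset (n P) → V G → Subset (n H)
  fiber U g = subsetOf λ h → ⟨ g , h ⟩ ∈? U

  FullLayer : Subset (n P) → V H → Set
  FullLayer U h = ∀ g → ⟨ g , h ⟩ ∈ U

  FullFiber : Subset (n P) → V G → Set
  FullFiber U g = ∀ h → ⟨ g , h ⟩ ∈ U

  module _ {U : Subset (n P)} where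

    ∈-layer⁺ : ∀ {g h} → ⟨ g , h ⟩ ∈ U → g ∈ layer U h
    ∈-layer⁺ {h = h} = ∈-subsetOf⁺ λ g → ⟨ g , h ⟩ ∈? U

    ∈-layer⁻ : ∀ {g h} → g ∈ layer U h → ⟨ g , h ⟩ ∈ U
    ∈-layer⁻ {h = h} = ∈-subsetOf⁻ λ g → ⟨ g , h ⟩ ∈? U

    ∈-fiber⁺ : ∀ {g h} → ⟨ g , h ⟩ ∈ U → h ∈ fiber U g
    ∈-fiber⁺ {g} = ∈-subsetOf⁺ λ h → ⟨ g , h ⟩ ∈? U

    ∈-fiber⁻ : ∀ {g h} → h ∈ fiber U g → ⟨ g , h ⟩ ∈ U
    ∈-fiber⁻ {g} = ∈-subsetOf⁻ λ h → ⟨ g , h ⟩ ∈? U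

    layer-convex : Convex P U → ∀ h → Convex G (layer U h)
    layer-convex convex h = bridgeClosed⇒convex {G} λ br → ∈-layer⁺ (convex⇒bridgeClosed {P} convex
      (map-Bridged {G} {P} ⟨_, h ⟩ ⟨⟩-injectiveˡ (adj-horizontal h) ∈-layer⁻ br))

    fiber-convex : Convex P U → ∀ g → Convex H (fiber U g)
    fiber-convex convex g = bridgeClosed⇒convex {H} λ br → ∈-fiber⁺ (convex⇒bridgeClosed {P} convex
      (map-Bridged {H} {P} ⟨ g ,_⟩ ⟨⟩-injectiveʳ (adj-vertical g) ∈-fiber⁻ br))

    hullSet⇒fullLayer : ∀ {S h} → HullSet G S → Convex P U → (∀ {g} → g ∈ S → ⟨ g , h ⟩ ∈ U) → FullLayer U h
    hullSet⇒fullLayer {h = h} hullSet convex S⊆ g = ∈-layer⁻ (hullSet g _ (∈-layer⁺ ∘ S⊆) (layer-convex convex h))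

    hullSet⇒fullFiber : ∀ {S g} → HullSet H S → Convex P U → (∀ {h} → h ∈ S → ⟨ g , h ⟩ ∈ U) → FullFiber U g
    hullSet⇒fullFiber {g = g} hullSet convex S⊆ h = ∈-fiber⁻ (hullSet h _ (∈-fiber⁺ ∘ S⊆) (fiber-convex convex g))

    square : Convex P U → ∀ {g g′ h h′} → Adj G g g′ → Adj H h h′ →
      ⟨ g , h ⟩ ∈ U → ⟨ g′ , h ⟩ ∈ U → ⟨ g , h′ ⟩ ∈ U → ⟨ g′ , h′ ⟩ ∈ U
    square convex {g} {g′} {h} {h′} g~g′ h~h′ gh∈ g′h∈ gh′∈ = convex⇒bridgeClosed {P} convex
      (bridge (Adj⇒≢ G g~g′ ∘ sym ∘ ⟨⟩-injectiveˡ)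
        (adj-vertical g′ (Adj-sym H h~h′)) (adj-horizontal h′ (Adj-sym G g~g′))
        (g′h∈ ∷⟨ adj-horizontal h (Adj-sym G g~g′) ⟩ gh∈ ∷⟨ adj-vertical g h~h′ ⟩ [ gh′∈ ]))

    fullFiber-step : Convex P U → Connected H → ∀ {g g′ h} →
      FullFiber U g → Adj G g g′ → ⟨ g′ , h ⟩ ∈ U → FullFiber U g′
    fullFiber-step convex connected {g} {g′} {h} full g~g′ g′h∈ h′ = along (connected h h′) g′h∈
      where
      along : ∀ {h₁ h₂} → Walk H h₁ h₂ → ⟨ g′ , h₁ ⟩ ∈ U → ⟨ g′ , h₂ ⟩ ∈ U
      along []              g′h₁∈ = g′h₁∈
      along (h₁~h₃ ∷ rest) g′h₁∈ = along rest (square convex g~g′ h₁~h₃ (full _) g′h₁∈ (full _))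

    fullFiber-along : Convex P U → Connected H → ∀ {Z h} → (∀ {z} → z ∈ Z → ⟨ z , h ⟩ ∈ U) →
      ∀ {g g′} → WalkIn G Z g g′ → FullFiber U g → FullFiber U g′
    fullFiber-along convex connected anchor [ _ ]                full = full
    fullFiber-along convex connected anchor (_ ∷⟨ g~v ⟩ rest) full =
      fullFiber-along convex connected anchor rest (fullFiber-step convex connected full g~v (anchor (head∈ rest)))

    fullFiber∧fullLayer⇒full : Convex P U → Connected G → Connected H →
      ∀ {g h} → FullFiber U g → FullLayer U h → ∀ x → x ∈ U
    fullFiber∧fullLayer⇒full convex connectedG connectedH {g} fullFiber fullLayer x =
      subst (_∈ U) (⟨π₁,π₂⟩ x)
        (fullFiber-along convex connectedH (λ {z} _ → fullLayer z) (walk⇒walkIn⊤ (connectedG g (π₁ x)))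
          fullFiber (π₂ x))

  π₁[_] : Subset (n P) → Subset (n G)
  π₁[ T ] = subsetOf λ g → any? λ h → ⟨ g , h ⟩ ∈? T

  module _ {T : Subset (n P)} where

    ∈-π₁[]⁺ : ∀ {x} → x ∈ T → π₁ x ∈ π₁[ T ]
    ∈-π₁[]⁺ {x} x∈T = ∈-subsetOf⁺ (λ g → any? λ h → ⟨ g , h ⟩ ∈? T)
      (π₂ x , subst (_∈ T) (sym (⟨π₁,π₂⟩ x)) x∈T)

    ∈-π₁[]⁻ : ∀ {g} → g ∈ π₁[ T ] → ∃ λ h → ⟨ g , h ⟩ ∈ T
    ∈-π₁[]⁻ = ∈-subsetOf⁻ λ g → any? λ h → ⟨ g , h ⟩ ∈? T

    ∣π₁[T]∣≤∣T∣ : ∣ π₁[ T ] ∣ ≤ ∣ T ∣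
    ∣π₁[T]∣≤∣T∣ = onto⇒∣q∣≤∣p∣ π₁ T π₁[ T ] λ {g} g∈ →
      let h , gh∈T = ∈-π₁[]⁻ g∈ in ⟨ g , h ⟩ , gh∈T , π₁-⟨⟩ g h

  π₁⁻¹ : Subset (n G) → Subset (n P)
  π₁⁻¹ C = subsetOf λ x → π₁ x ∈? C

  module _ {C : Subset (n G)} where

    ∈-π₁⁻¹⁺ : ∀ {x} → π₁ x ∈ C → x ∈ π₁⁻¹ C
    ∈-π₁⁻¹⁺ = ∈-subsetOf⁺ λ x → π₁ x ∈? C

    ∈-π₁⁻¹⁻ : ∀ {x} → x ∈ π₁⁻¹ C → π₁ x ∈ C
    ∈-π₁⁻¹⁻ = ∈-subsetOf⁻ λ x → π₁ x ∈? C

    walkIn-π₁ : ∀ {x y} → WalkIn P (π₁⁻¹ C) x y → WalkIn G C (π₁ x) (π₁ y)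
    walkIn-π₁ [ x∈ ] = [ ∈-π₁⁻¹⁻ x∈ ]
    walkIn-π₁ {y = y} (x∈ ∷⟨ x~z ⟩ rest) with □-adj⁻ x~z
    ... | inj₁ (g~g′ , _) = ∈-π₁⁻¹⁻ x∈ ∷⟨ g~g′ ⟩ walkIn-π₁ rest
    ... | inj₂ (g≡g′ , _) = subst (λ g → WalkIn G C g (π₁ y)) (sym g≡g′) (walkIn-π₁ rest)

    π₁⁻¹-convex : Convex G C → Convex P (π₁⁻¹ C)
    π₁⁻¹-convex convex = bridgeClosed⇒convex {P} λ br → ∈-π₁⁻¹⁺ (closed br (□-adj⁻ (w~p br)) (□-adj⁻ (w~q br)))
      where
      open Bridged
      closed : ∀ {x} (br : Bridged P (π₁⁻¹ C) x) →
        Horizontal x (p br) ⊎ Vertical x (p br) → Horizontal x (q br) ⊎ Vertical x (q br) → π₁ x ∈ C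
      closed br (inj₂ (x≡p , _)) _ = subst (_∈ C) (sym x≡p) (∈-π₁⁻¹⁻ (head∈ (p⇝q br)))
      closed br _ (inj₂ (x≡q , _)) = subst (_∈ C) (sym x≡q) (∈-π₁⁻¹⁻ (last∈ (p⇝q br)))
      closed br (inj₁ (x~p , x≡p)) (inj₁ (x~q , x≡q)) = convex⇒bridgeClosed {G} convex
        (bridge (λ p≡q → p≢q br (π-injective p≡q (trans (sym x≡p) x≡q))) x~p x~q (walkIn-π₁ (p⇝q br)))

  hullSet-π₁[] : V H → ∀ {T} → HullSet P T → HullSet G π₁[ T ]
  hullSet-π₁[] h {T} hullSet g C π₁[T]⊆C convex = subst (_∈ C) (π₁-⟨⟩ g h)
    (∈-π₁⁻¹⁻ (hullSet ⟨ g , h ⟩ (π₁⁻¹ C) (∈-π₁⁻¹⁺ ∘ π₁[T]⊆C ∘ ∈-π₁[]⁺) (π₁⁻¹-convex convex)))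

  graphOn : Subset (n G) → (V G → V H) → Subset (n P)
  graphOn S σ = subsetOf λ x → (π₁ x ∈? S) ×-dec (π₂ x ≟ σ (π₁ x))

  module _ {S : Subset (n G)} {σ : V G → V H} where

    ∈-graphOn⁺ : ∀ {g} → g ∈ S → ⟨ g , σ g ⟩ ∈ graphOn S σ
    ∈-graphOn⁺ {g} g∈S = ∈-subsetOf⁺ (λ x → (π₁ x ∈? S) ×-dec (π₂ x ≟ σ (π₁ x)))
      (subst (_∈ S) (sym (π₁-⟨⟩ g (σ g))) g∈S , trans (π₂-⟨⟩ g (σ g)) (cong σ (sym (π₁-⟨⟩ g (σ g)))))

    ∈-graphOn⁻ : ∀ {x} → x ∈ graphOn S σ → π₁ x ∈ S × π₂ x ≡ σ (π₁ x)
    ∈-graphOn⁻ = ∈-subsetOf⁻ λ x → (π₁ x ∈? S) ×-dec (π₂ x ≟ σ (π₁ x))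

    ∣graphOn∣≤∣S∣ : ∣ graphOn S σ ∣ ≤ ∣ S ∣
    ∣graphOn∣≤∣S∣ = onto⇒∣q∣≤∣p∣ (λ g → ⟨ g , σ g ⟩) S (graphOn S σ) λ {x} x∈ →
      let π₁x∈S , π₂x≡σπ₁x = ∈-graphOn⁻ x∈
      in  π₁ x , π₁x∈S , trans (cong ⟨ π₁ x ,_⟩ (sym π₂x≡σπ₁x)) (⟨π₁,π₂⟩ x)

  module _ {T : Subset (n P)} (T-hullSet : HullSet P T) where

    LayerHullsMeet : Set
    LayerHullsMeet = ∃₂ λ h h′ → h ≢ h′ × ∃ λ g → g ∈ hull G (layer T h) × g ∈ hull G (layer T h′)

    layerHullsMeet? : Dec LayerHullsMeet
    layerHullsMeet? = any? λ h → any? λ h′ → ¬? (h ≟ h′) ×-dec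
      any? λ g → (g ∈? hull G (layer T h)) ×-dec (g ∈? hull G (layer T h′))

    -- ⋃ₕ ⟨Tₕ⟩ × {h}; if the ⟨Tₕ⟩ are pairwise disjoint, no walk inside it takes a vertical step.
    stacked : Subset (n P)
    stacked = subsetOf λ x → π₁ x ∈? hull G (layer T (π₂ x))

    ∈-stacked⁻ : ∀ {x} → x ∈ stacked → π₁ x ∈ hull G (layer T (π₂ x))
    ∈-stacked⁻ = ∈-subsetOf⁻ λ x → π₁ x ∈? hull G (layer T (π₂ x))

    WalkInLayerHull : V H → V G → V G → Set
    WalkInLayerHull h = WalkIn G (hull G (layer T h))

    module _ (disjoint : ¬ LayerHullsMeet) where

      stacked-prepend : ∀ {x z y} → x ∈ stacked → z ∈ stacked → Horizontal x z ⊎ Vertical x z →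
        π₂ z ≡ π₂ y × WalkInLayerHull (π₂ z) (π₁ z) (π₁ y) → π₂ x ≡ π₂ y × WalkInLayerHull (π₂ x) (π₁ x) (π₁ y)
      stacked-prepend {x} {z} {y} x∈ _ (inj₁ (g~g′ , x≡z)) (z≡y , walk) =
        trans x≡z z≡y , ∈-stacked⁻ x∈ ∷⟨ g~g′ ⟩ subst (λ h → WalkInLayerHull h (π₁ z) (π₁ y)) (sym x≡z) walk
      stacked-prepend {x} {z} x∈ z∈ (inj₂ (x≡z , x~z)) _ = contradiction
        (π₂ x , π₂ z , Adj⇒≢ H x~z , π₁ x , ∈-stacked⁻ x∈ ,
          subst (λ g → g ∈ hull G (layer T (π₂ z))) (sym x≡z) (∈-stacked⁻ z∈))
        disjoint

      walkIn-stacked : ∀ {x y} → WalkIn P stacked x y → π₂ x ≡ π₂ y × WalkInLayerHull (π₂ x) (π₁ x) (π₁ y)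
      walkIn-stacked [ x∈ ]              = refl , [ ∈-stacked⁻ x∈ ]
      walkIn-stacked (x∈ ∷⟨ x~z ⟩ rest) = stacked-prepend x∈ (head∈ rest) (□-adj⁻ x~z) (walkIn-stacked rest)

      stacked-convex : Convex P stacked
      stacked-convex = bridgeClosed⇒convex {P} λ (bridge p≢q x~p x~q p⇝q) →
        ∈-subsetOf⁺ (λ x → π₁ x ∈? hull G (layer T (π₂ x)))
          (closed p≢q (walkIn-stacked p⇝q) (□-adj⁻ x~p) (□-adj⁻ x~q))
        where
        closed : ∀ {x p q} → p ≢ q → π₂ p ≡ π₂ q × WalkInLayerHull (π₂ p) (π₁ p) (π₁ q) →
          Horizontal x p ⊎ Vertical x p → Horizontal x q ⊎ Vertical x q → π₁ x ∈ hull G (layer T (π₂ x))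
        closed {x} {p} {q} p≢q (p≡q , walk) (inj₁ (x~p , x≡p)) (inj₁ (x~q , _)) = convex⇒bridgeClosed {G} hull-convex
          (bridge (λ eq → p≢q (π-injective eq p≡q)) x~p x~q
            (subst (λ h → WalkInLayerHull h (π₁ p) (π₁ q)) (sym x≡p) walk))
        closed _ (p≡q , _) (inj₁ (_ , x≡p)) (inj₂ (_ , x~q)) = contradiction (trans x≡p p≡q) (Adj⇒≢ H x~q)
        closed _ (p≡q , _) (inj₂ (_ , x~p)) (inj₁ (_ , x≡q)) = contradiction (trans x≡q (sym p≡q)) (Adj⇒≢ H x~p)
        closed p≢q (p≡q , _) (inj₂ (x≡p , _)) (inj₂ (x≡q , _)) =
          contradiction (π-injective (trans (sym x≡p) x≡q) p≡q) p≢q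

    layerHulls-meet : ∀ {h h′} → h ≢ h′ → V G → LayerHullsMeet
    layerHulls-meet {h} {h′} h≢h′ g = decide layerHullsMeet?
      where
      T⊆stacked : T ⊆ stacked
      T⊆stacked {x} x∈T = ∈-subsetOf⁺ (λ x → π₁ x ∈? hull G (layer T (π₂ x)))
        (⊆-hull (∈-layer⁺ (subst (_∈ T) (sym (⟨π₁,π₂⟩ x)) x∈T)))
      in-hull : ¬ LayerHullsMeet → ∀ h → g ∈ hull G (layer T h)
      in-hull disjoint h = subst₂ (λ g h → g ∈ hull G (layer T h)) (π₁-⟨⟩ g h) (π₂-⟨⟩ g h)
        (∈-stacked⁻ (T-hullSet ⟨ g , h ⟩ stacked T⊆stacked (stacked-convex disjoint)))
      decide : Dec LayerHullsMeet → LayerHullsMeet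
      decide (yes meet)     = meet
      decide (no disjoint) = contradiction (h , h′ , h≢h′ , g , in-hull disjoint h , in-hull disjoint h′) disjoint

    module _ (T-min : ∀ R → HullSet G R → ∣ T ∣ ≤ ∣ R ∣) where

      π₁-injectiveOn : ∀ {x y} → x ∈ T → y ∈ T → π₁ x ≡ π₁ y → x ≡ y
      π₁-injectiveOn {x} {y} x∈T y∈T π₁x≡π₁y with x ≟ y
      ... | yes x≡y = x≡y
      ... | no x≢y  = contradiction
        (T-min π₁[ T - y ] (HullSet-mono {G} π₁[T]⊆π₁[T-y] (hullSet-π₁[] (π₂ x) T-hullSet)))
        (ℕ.<⇒≱ (ℕ.≤-<-trans ∣π₁[T]∣≤∣T∣ (x∈p⇒∣p-x∣<∣p∣ y∈T)))
        where
        π₁[T]⊆π₁[T-y] : π₁[ T ] ⊆ π₁[ T - y ]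
        π₁[T]⊆π₁[T-y] {g} g∈ with h , gh∈T ← ∈-π₁[]⁻ g∈ with ⟨ g , h ⟩ ≟ y
        ... | yes gh≡y = subst (_∈ π₁[ T - y ]) (trans π₁x≡π₁y (trans (cong π₁ (sym gh≡y)) (π₁-⟨⟩ g h)))
                           (∈-π₁[]⁺ (x∈p∧x≢y⇒x∈p-y x∈T x≢y))
        ... | no gh≢y  = subst (_∈ π₁[ T - y ]) (π₁-⟨⟩ g h) (∈-π₁[]⁺ (x∈p∧x≢y⇒x∈p-y gh∈T gh≢y))

      minimum⇒partition : ∀ {h h′ : V H} → h ≢ h′ → V G → PartitionCondition G
      minimum⇒partition h≢h′ g₀ with layerHulls-meet h≢h′ g₀
      ... | h , h′ , h≢h′ , g , g∈⟨Tₕ⟩ , g∈⟨Tₕ′⟩ =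
        π₁[ T ] , (hullSet-π₁[] h T-hullSet , λ R R-hullSet → ≤-trans ∣π₁[T]∣≤∣T∣ (T-min R R-hullSet)) ,
        layer T h , π₁[ T ] ─ layer T h , p⊆q⇒p∪q─p≡q (layer⊆π₁[T] h) ,
        (λ v (v∈S₁ , v∈S₂) → x∈p─q⇒x∉q π₁[ T ] (layer T h) v∈S₂ v∈S₁) ,
        g , ∈-hull⁻ g∈⟨Tₕ⟩ , InHull-mono {G} Tₕ′⊆S₂ (∈-hull⁻ g∈⟨Tₕ′⟩)
        where
        layer⊆π₁[T] : ∀ h → layer T h ⊆ π₁[ T ]
        layer⊆π₁[T] h {g} g∈ = subst (_∈ π₁[ T ]) (π₁-⟨⟩ g h) (∈-π₁[]⁺ (∈-layer⁻ g∈))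
        Tₕ′⊆S₂ : layer T h′ ⊆ π₁[ T ] ─ layer T h
        Tₕ′⊆S₂ {g} g∈Tₕ′ = x∈p∧x∉q⇒x∈p─q (layer⊆π₁[T] h′ g∈Tₕ′) λ g∈Tₕ →
          h≢h′ (⟨⟩-injectiveʳ (π₁-injectiveOn (∈-layer⁻ g∈Tₕ) (∈-layer⁻ g∈Tₕ′)
            (trans (π₁-⟨⟩ g h) (sym (π₁-⟨⟩ g h′)))))

module TwoPointHullSet (G H : Graph) (connectedG : Connected G) (connectedH : Connected H)
    {SH : Subset (n H)} (SH-hullSet : HullSet H SH) {a b : V H} (SH⊆ab : ∀ {h} → h ∈ SH → h ≡ a ⊎ h ≡ b) where

  open Product G H

  fullFiber-ab : ∀ {U} → Convex P U → ∀ {g} → ⟨ g , a ⟩ ∈ U → ⟨ g , b ⟩ ∈ U → FullFiber U g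
  fullFiber-ab {U} convex {g} ga∈U gb∈U = hullSet⇒fullFiber SH-hullSet convex SH⊆fiber
    where
    SH⊆fiber : ∀ {h} → h ∈ SH → ⟨ g , h ⟩ ∈ U
    SH⊆fiber h∈SH with SH⊆ab h∈SH
    ... | inj₁ refl = ga∈U
    ... | inj₂ refl = gb∈U

  withApex : Subset (n G) → V G → Subset (n P)
  withApex S s = graphOn S (λ _ → a) ∪ ⁅ ⟨ s , b ⟩ ⁆

  withApex-hullSet : ∀ {S} → HullSet G S → ∀ s → HullSet P (withApex S s)
  withApex-hullSet {S} S-hullSet s x U withApex⊆U convex =
    fullFiber∧fullLayer⇒full convex connectedG connectedH fullFiber-s fullLayer-a x
    where
    fullLayer-a : FullLayer U a
    fullLayer-a = hullSet⇒fullLayer S-hullSet convex λ g∈S →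
      withApex⊆U (x∈p∪q⁺ (inj₁ (∈-graphOn⁺ {S} {λ _ → a} g∈S)))
    fullFiber-s : FullFiber U s
    fullFiber-s = fullFiber-ab convex (fullLayer-a s) (withApex⊆U (x∈p∪q⁺ (inj₂ (x∈⁅x⁆ ⟨ s , b ⟩))))

  ∣withApex∣≤1+∣S∣ : ∀ S s → ∣ withApex S s ∣ ≤ suc ∣ S ∣
  ∣withApex∣≤1+∣S∣ S s =
    ≤-trans (∣p∪⁅x⁆∣≤1+∣p∣ (graphOn S (λ _ → a)) ⟨ s , b ⟩) (s≤s (∣graphOn∣≤∣S∣ {S} {λ _ → a}))

  module Split (S S₂ : Subset (n G)) (v : V G) where

    K : Subset (n G)
    K = reach G (hull G S₂) v

    B : Subset (n G)
    B = S₂ ∩ K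

    side : V G → V H
    side g = if does (g ∈? B) then b else a

    side-B : ∀ {g} → g ∈ B → side g ≡ b
    side-B {g} g∈B = cong (if_then b else a) (dec-true (g ∈? B) g∈B)

    side-∉B : ∀ {g} → g ∉ B → side g ≡ a
    side-∉B {g} g∉B = cong (if_then b else a) (dec-false (g ∈? B) g∉B)

    split : Subset (n P)
    split = graphOn S side

    ∣split∣≤∣S∣ : ∣ split ∣ ≤ ∣ S ∣
    ∣split∣≤∣S∣ = ∣graphOn∣≤∣S∣ {S} {side}

    split-hullSet : ∀ {S₁} → HullSet G S → S₁ ∪ S₂ ≡ S → (∀ v → ¬ (v ∈ S₁ × v ∈ S₂)) →
      InHull G S₁ v → InHull G S₂ v → HullSet P split
    split-hullSet {S₁} S-hullSet S₁∪S₂≡S disjoint v∈⟨S₁⟩ v∈⟨S₂⟩ x U split⊆U convex =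
      fullFiber∧fullLayer⇒full convex connectedG connectedH (fullFiber-K v∈K) fullLayer-a x
      where
      placed : ∀ {g} → g ∈ S → ⟨ g , side g ⟩ ∈ U
      placed = split⊆U ∘ ∈-graphOn⁺ {S} {side}
      S₁⊆S : S₁ ⊆ S
      S₁⊆S = subst (S₁ ⊆_) S₁∪S₂≡S (x∈p∪q⁺ ∘ inj₁)
      S₂⊆S : S₂ ⊆ S
      S₂⊆S = subst (S₂ ⊆_) S₁∪S₂≡S (x∈p∪q⁺ ∘ inj₂)
      B⊆layer-b : B ⊆ layer U b
      B⊆layer-b {g} g∈B = ∈-layer⁺ (subst (λ h → ⟨ g , h ⟩ ∈ U) (side-B g∈B)
        (placed (S₂⊆S (proj₁ (x∈p∩q⁻ S₂ K g∈B)))))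
      K-on-b : ∀ {g} → g ∈ K → ⟨ g , b ⟩ ∈ U
      K-on-b g∈K = ∈-layer⁻ (reach-hull⊆convex {G} {S₂} {layer U b} v (layer-convex convex b) B⊆layer-b g∈K)
      v∈K : v ∈ K
      v∈K = reach-start G (hull G S₂) (∈-hull⁺ v∈⟨S₂⟩)
      S₁⊆layer-a : S₁ ⊆ layer U a
      S₁⊆layer-a {g} g∈S₁ = ∈-layer⁺ (subst (λ h → ⟨ g , h ⟩ ∈ U)
        (side-∉B λ g∈B → disjoint g (g∈S₁ , proj₁ (x∈p∩q⁻ S₂ K g∈B))) (placed (S₁⊆S g∈S₁)))
      fullFiber-v : FullFiber U v
      fullFiber-v = fullFiber-ab convex (∈-layer⁻ (v∈⟨S₁⟩ (layer U a) S₁⊆layer-a (layer-convex convex a)))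
        (K-on-b v∈K)
      fullFiber-K : ∀ {g} → g ∈ K → FullFiber U g
      fullFiber-K g∈K = fullFiber-along convex connectedH {K} {b} K-on-b
        (walkIn-reach G (hull G S₂) v∈K (reach⇒walk G (hull G S₂) g∈K)) fullFiber-v
      fullLayer-a : FullLayer U a
      fullLayer-a = hullSet⇒fullLayer S-hullSet convex on-a
        where
        on-a : ∀ {g} → g ∈ S → ⟨ g , a ⟩ ∈ U
        on-a {g} g∈S = by-cases (g ∈? B)
          where
          by-cases : Dec (g ∈ B) → ⟨ g , a ⟩ ∈ U
          by-cases (yes g∈B) = fullFiber-K (proj₂ (x∈p∩q⁻ S₂ K g∈B)) a
          by-cases (no g∉B)  = subst (λ h → ⟨ g , h ⟩ ∈ U) (side-∉B g∉B) (placed g∈S)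

mainTheorem4 : (G H : Graph) → Nontrivial G → Nontrivial H → Connected G → Connected H →
    IsHullNumber H 2 → (k k′ : ℕ) → IsHullNumber G k → IsHullNumber (G □ H) k′ →
      (k ≤ k′ × k′ ≤ suc k) × ((k′ ≡ k) ⇔ PartitionCondition G)
mainTheorem4 G H nontrivialG _ connectedG connectedH (SH , (SH-hullSet , _) , ∣SH∣≡2) k k′
  (S , (S-hullSet , S-min) , ∣S∣≡k) (T , (T-hullSet , T-min) , ∣T∣≡k′)
  with a , b , a≢b , SH⊆ab ← ∣p∣≡2⇒pair SH ∣SH∣≡2 =
  (k≤k′ , k′≤1+k) , mk⇔ equal⇒partition partition⇒equal
  where
  open Product G H
  open TwoPointHullSet G H connectedG connectedH SH-hullSet SH⊆ab
  g₀ : V G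
  g₀ = fromℕ< (≤-trans (s≤s z≤n) nontrivialG)
  k≤ : ∀ R → HullSet G R → k ≤ ∣ R ∣
  k≤ R R-hullSet = subst (_≤ ∣ R ∣) ∣S∣≡k (S-min R R-hullSet)
  k≤k′ : k ≤ k′
  k≤k′ = subst (k ≤_) ∣T∣≡k′ (≤-trans (k≤ π₁[ T ] (hullSet-π₁[] a T-hullSet)) ∣π₁[T]∣≤∣T∣)
  k′≤1+k : k′ ≤ suc k
  k′≤1+k = subst₂ (λ k′ k → k′ ≤ suc k) ∣T∣≡k′ ∣S∣≡k
    (≤-trans (T-min (withApex S g₀) (withApex-hullSet S-hullSet g₀)) (∣withApex∣≤1+∣S∣ S g₀))
  equal⇒partition : k′ ≡ k → PartitionCondition G
  equal⇒partition k′≡k =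
    minimum⇒partition T-hullSet (λ R → subst (_≤ ∣ R ∣) (sym (trans ∣T∣≡k′ k′≡k)) ∘ k≤ R) a≢b g₀
  partition⇒equal : PartitionCondition G → k′ ≡ k
  partition⇒equal (S′ , (S′-hullSet , S′-min) , S₁ , S₂ , S₁∪S₂≡S′ , disjoint , v , v∈⟨S₁⟩ , v∈⟨S₂⟩) =
    ℕ.≤-antisym (subst₂ _≤_ ∣T∣≡k′ ∣S∣≡k ∣T∣≤∣S∣) k≤k′
    where
    open Split S′ S₂ v
    ∣T∣≤∣S∣ : ∣ T ∣ ≤ ∣ S ∣
    ∣T∣≤∣S∣ = ≤-trans (T-min split (split-hullSet S′-hullSet S₁∪S₂≡S′ disjoint v∈⟨S₁⟩ v∈⟨S₂⟩))
                (≤-trans ∣split∣≤∣S∣ (S′-min S S-hullSet))
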